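{- Let $d\geq1$ and let $H$ be a graph with maximum degree at most $d$. For integers $\ell,x,c\geq 0$, let $\mathcal{J}^H_{\ell,x,c}$ be the set of all subgraphs $J\subset H$ with $\ell$ edges, $x$ non-isolated vertices and $c$ connected components (not counting isolated vertices). Then $$|\mathcal{J}^H_{\ell,x,c}|\leq\binom{\min\{|E(H)|,|V(H)|\}}{c}(16d)^{\ell}.$$ -}

module Defs where

open import Data.Nat using (ℕ; _≤_)
open import Data.Fin using (Fin)
open import Data.Fin.Subset using (Subset; _∈_; ∣_∣)
open import Data.Vec using (tabulate)
open import Data.Bool using (Bool; true; false; _∨_)
open import Data.Product using (Σ; _×_; _,_; proj₁; proj₂; ∃)
open import Data.Sum using (_⊎_)
open import Data.Fin using (_≟_)
open import Relation.Nullary using (¬_; does)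
open import Relation.Binary.PropositionalEquality using (_≡_; _≢_)
open import Function.Bundles using (_⇔_)

record Graph : Set where
  field
    n : ℕ
    m : ℕ
    ends : Fin m → Fin n × Fin n
    noLoop : ∀ e → proj₁ (ends e) ≢ proj₂ (ends e)
    simple : ∀ e e' → (ends e ≡ ends e' ⊎ (proj₁ (ends e) ≡ proj₂ (ends e') × proj₂ (ends e) ≡ proj₁ (ends e')))
                    → e ≡ e'

open Graph public

incidentB : (H : Graph) → Fin (n H) → Fin (m H) → Bool
incidentB H v e = does (v ≟ proj₁ (ends H e)) ∨ does (v ≟ proj₂ (ends H e))

anyFin : ∀ {k} → (Fin k → Bool) → Bool
anyFin {ℕ.zero} p = false
anyFin {ℕ.suc k} p = p Fin.zero ∨ anyFin (λ i → p (Fin.suc i))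

degree : (H : Graph) → Fin (n H) → ℕ
degree H v = ∣ tabulate (incidentB H v) ∣

MaxDegree≤ : Graph → ℕ → Set
MaxDegree≤ H d = ∀ v → degree H v ≤ d

-- A subgraph J ⊆ H is given by its edge set (isolated vertices are irrelevant).
SubG : Graph → Set
SubG H = Subset (m H)

nonIsoB : (H : Graph) → SubG H → Fin (n H) → Bool
nonIsoB H J v = anyFin (λ e → Data.Vec.lookup J e Data.Bool.∧ incidentB H v e)
  where import Data.Vec; import Data.Bool

NonIso : (H : Graph) → SubG H → Fin (n H) → Set
NonIso H J v = nonIsoB H J v ≡ true

numNonIso : (H : Graph) → SubG H → ℕ
numNonIso H J = ∣ tabulate (nonIsoB H J) ∣

data Reach (H : Graph) (J : SubG H) : Fin (n H) → Fin (n H) → Set where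
  here : ∀ {u} → Reach H J u u
  step : ∀ {u w} e → e ∈ J
         → (proj₁ (ends H e) ≡ u × proj₂ (ends H e) ≡ w ⊎ proj₂ (ends H e) ≡ u × proj₁ (ends H e) ≡ w)
         → ∀ {v} → Reach H J w v → Reach H J u v

-- J has exactly c connected components (not counting isolated vertices):
-- the reachability classes of non-isolated vertices are in bijection with Fin c,
-- witnessed by a labelling f that is surjective onto Fin c on non-isolated vertices
-- and identifies exactly the mutually reachable non-isolated vertices.
HasComponents : (H : Graph) → SubG H → ℕ → Set
HasComponents H J c =
  Σ (Fin (n H) → Fin c) λ f →
    (∀ u v → NonIso H J u → NonIso H J v → (f u ≡ f v ⇔ Reach H J u v))
    × (∀ k → ∃ λ v → NonIso H J v × f v ≡ k)

InJ : (H : Graph) → ℕ → ℕ → ℕ → SubG H → Set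
InJ H ℓ x c J = ∣ J ∣ ≡ ℓ × numNonIso H J ≡ x × HasComponents H J c

-- Every component of J has an edge, so c <= l.  Pick a root in every component:
-- a vertex, or an edge (through its first endpoint) when H has fewer edges than
-- vertices.  The roots form a c-element subset of the smaller of V(H) and E(H),
-- so there are at most binom(min(|E(H)|,|V(H)|), c) choices.  From its roots J
-- is recovered by a depth-first search on a stack of vertices: while the top
-- vertex has an edge of J not yet taken, take it and replace the vertex by both
-- endpoints; otherwise pop it.  A step of the first kind has at most d choices
-- and happens l times; it grows the stack by one vertex and a pop removes one,
-- so there are at most c + l <= 2l pops.  Hence each root set yields at most
-- 2^(2l) (2d)^l <= (16d)^l candidates for J.
module Submission where

open import Defs
open import Data.Bool using (Bool; true; false; _∧_)
open import Data.Bool.Properties using (∧-conicalˡ; ∧-conicalʳ)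
open import Data.Fin using (Fin; zero; suc; _≟_)
open import Data.Fin.Properties using (any?)
open import Data.Fin.Subset
  using (Subset; inside; outside; _∈_; _∉_; _⊆_; _∪_; _─_; _-_; ⁅_⁆; ∣_∣)
  renaming (⊥ to ∅)
open import Data.Fin.Subset.Properties
  using (_∈?_; ∉⊥; ⊆-min; ⊆-antisym; x∈p∪q⁻; x∈p∪q⁺; x∈⁅y⁆⇒x≡y; x∈p∧x∉q⇒x∈p─q;
         p─⊥≡p; p─q─r≡p─q∪r; x∈p⇒∣p-x∣<∣p∣)
open import Data.List using (List; []; _∷_; [_]; _++_; map; concatMap; length; allFin; filter)
open import Data.List.Properties using (length-map; length-++; length-tabulate; length-removeAt′)
open import Data.List.Membership.Propositional using (lose) renaming (_∈_ to _∈ₗ_)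
open import Data.List.Membership.Propositional.Properties
  using (∈-map⁺; ∈-map⁻; ∈-++⁺ˡ; ∈-++⁺ʳ; ∈-concatMap⁺; ∈-filter⁺; ∈-filter⁻; ∈-allFin)
open import Data.List.Relation.Binary.Subset.Propositional using () renaming (_⊆_ to _⊆ₗ_)
open import Data.List.Relation.Binary.Sublist.Propositional using ([]; _∷ʳ_) renaming (_⊆_ to _⊑_; _∷_ to _∷ₛ_)
open import Data.List.Relation.Binary.Sublist.Propositional.Properties using (filter-⊆)
open import Data.List.Relation.Unary.All using (All)
import Data.List.Relation.Unary.All as All
open import Data.List.Relation.Unary.Any using (here; there; index) renaming (_─_ to _─ₗ_)
import Data.List.Relation.Unary.AllPairs as AllPairs
open import Data.List.Relation.Unary.Unique.Propositional using (Unique)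
open import Data.List.Relation.Unary.Unique.Propositional.Properties using (map⁺; filter⁺; allFin⁺)
open import Data.Nat using (ℕ; zero; suc; _+_; _*_; _^_; _⊓_; _≤_; z≤n; s≤s; _≤?_)
open import Data.Nat.Combinatorics using (_C_; nCk+nC[k+1]≡[n+1]C[k+1])
open import Data.Nat.Properties hiding (_≟_)
open import Data.Nat.Tactic.RingSolver using (solve-∀)
open import Data.Product using (Σ; ∃; _×_; _,_; proj₁; proj₂)
open import Data.Sum using (_⊎_; inj₁; inj₂)
open import Data.Vec as Vec using (tabulate; lookup)
open import Data.Vec.Properties using (lookup∘tabulate; lookup⇒[]=; []=⇒lookup)
open import Function using (_∘_; id; _⇔_; Equivalence)
open import Function.Definitions using (Injective)
open import Relation.Binary.PropositionalEquality
  using (_≡_; _≢_; refl; sym; trans; cong; cong₂; subst; subst₂; module ≡-Reasoning)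
open import Relation.Nullary using (¬_; Dec; yes; no; contradiction)
open import Relation.Nullary.Decidable using (_×-dec_; _⊎-dec_; ¬?)

module _ {a} {A : Set a} where

  ∈-─⁺ : ∀ {x y : A} {ys} (x∈ys : x ∈ₗ ys) → y ∈ₗ ys → y ≢ x → y ∈ₗ (ys ─ₗ x∈ys)
  ∈-─⁺ (here refl)  (here refl)  y≢x = contradiction refl y≢x
  ∈-─⁺ (here refl)  (there y∈ys) _   = y∈ys
  ∈-─⁺ (there _)    (here refl)  _   = here refl
  ∈-─⁺ (there x∈ys) (there y∈ys) y≢x = there (∈-─⁺ x∈ys y∈ys y≢x)

  Unique-⊆⇒length≤ : ∀ {xs ys : List A} → Unique xs → xs ⊆ₗ ys → length xs ≤ length ys
  Unique-⊆⇒length≤ {[]}     _                          _     = z≤n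
  Unique-⊆⇒length≤ {x ∷ xs} {ys} (x∉xs AllPairs.∷ uniq) xs⊆ys = begin
    suc (length xs)           ≤⟨ s≤s (Unique-⊆⇒length≤ uniq xs⊆ys─x) ⟩
    suc (length (ys ─ₗ x∈ys)) ≡⟨ length-removeAt′ ys (index x∈ys) ⟨
    length ys                 ∎
    where
    open ≤-Reasoning
    x∈ys : x ∈ₗ ys
    x∈ys = xs⊆ys (here refl)
    xs⊆ys─x : xs ⊆ₗ (ys ─ₗ x∈ys)
    xs⊆ys─x y∈xs = ∈-─⁺ x∈ys (xs⊆ys (there y∈xs)) λ y≡x → All.lookup x∉xs y∈xs (sym y≡x)

  length-concatMap≤ : ∀ {b} {B : Set b} (f : B → List A) {K} xs →
                      (∀ x → length (f x) ≤ K) → length (concatMap f xs) ≤ length xs * K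
  length-concatMap≤ f []       _ = z≤n
  length-concatMap≤ f {K} (x ∷ xs) bound = begin
    length (f x ++ concatMap f xs)          ≡⟨ length-++ (f x) ⟩
    length (f x) + length (concatMap f xs)  ≤⟨ +-mono-≤ (bound x) (length-concatMap≤ f xs bound) ⟩
    K + length xs * K                       ∎
    where open ≤-Reasoning

  combinations : ℕ → List A → List (List A)
  combinations zero    _        = [ [] ]
  combinations (suc k) []       = []
  combinations (suc k) (x ∷ xs) = map (x ∷_) (combinations k xs) ++ combinations (suc k) xs

  length-combinations : ∀ k xs → length (combinations k xs) ≡ length xs C k
  length-combinations zero    _        = refl
  length-combinations (suc k) []       = refl
  length-combinations (suc k) (x ∷ xs) = begin
    length (map (x ∷_) (combinations k xs) ++ combinations (suc k) xs)
      ≡⟨ length-++ (map (x ∷_) (combinations k xs)) ⟩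
    length (map (x ∷_) (combinations k xs)) + length (combinations (suc k) xs)
      ≡⟨ cong₂ _+_ (trans (length-map (x ∷_) (combinations k xs)) (length-combinations k xs))
                   (length-combinations (suc k) xs) ⟩
    length xs C k + length xs C suc k
      ≡⟨ nCk+nC[k+1]≡[n+1]C[k+1] (length xs) k ⟩
    length (x ∷ xs) C suc k ∎
    where open ≡-Reasoning

  ∈-combinations : ∀ {ys xs : List A} → ys ⊑ xs → ys ∈ₗ combinations (length ys) xs
  ∈-combinations []                   = here refl
  ∈-combinations {[]}    (_ ∷ʳ _)     = here refl
  ∈-combinations {_ ∷ _} (x ∷ʳ ys⊑xs) = ∈-++⁺ʳ (map (x ∷_) _) (∈-combinations ys⊑xs)
  ∈-combinations (refl ∷ₛ ys⊑xs)      = ∈-++⁺ˡ (∈-map⁺ _ (∈-combinations ys⊑xs))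

module _ {c M : ℕ} (g : Fin c → Fin M) where

  private
    hit? : (i : Fin M) → Dec (∃ λ k → g k ≡ i)
    hit? i = any? (λ k → g k ≟ i)

  image : List (Fin M)
  image = filter hit? (allFin M)

  image⊑allFin : image ⊑ allFin M
  image⊑allFin = filter-⊆ hit? (allFin M)

  ∈-image : ∀ k → g k ∈ₗ image
  ∈-image k = ∈-filter⁺ hit? (∈-allFin (g k)) (k , refl)

  length-image : Injective _≡_ _≡_ g → length image ≡ c
  length-image g-injective = ≤-antisym
    (subst (length image ≤_) length-g[allFin]
      (Unique-⊆⇒length≤ (filter⁺ hit? (allFin⁺ M)) image⊆g[allFin]))
    (subst (_≤ length image) length-g[allFin]
      (Unique-⊆⇒length≤ (map⁺ g-injective (allFin⁺ c)) g[allFin]⊆image))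
    where
    length-g[allFin] : length (map g (allFin c)) ≡ c
    length-g[allFin] = trans (length-map g (allFin c)) (length-tabulate id)
    image⊆g[allFin] : image ⊆ₗ map g (allFin c)
    image⊆g[allFin] i∈image with ∈-filter⁻ hit? {xs = allFin M} i∈image
    ... | _ , k , refl = ∈-map⁺ g (∈-allFin k)
    g[allFin]⊆image : map g (allFin c) ⊆ₗ image
    g[allFin]⊆image i∈ with ∈-map⁻ g i∈
    ... | k , _ , refl = ∈-image k

elements : ∀ {k} → Subset k → List (Fin k)
elements Vec.[]            = []
elements (inside Vec.∷ p)  = zero ∷ map suc (elements p)
elements (outside Vec.∷ p) = map suc (elements p)

length-elements : ∀ {k} (p : Subset k) → length (elements p) ≡ ∣ p ∣
length-elements Vec.[]            = refl
length-elements (inside Vec.∷ p)  = cong suc (trans (length-map suc (elements p)) (length-elements p))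
length-elements (outside Vec.∷ p) = trans (length-map suc (elements p)) (length-elements p)

∈-elements⁺ : ∀ {k} {p : Subset k} {i} → i ∈ p → i ∈ₗ elements p
∈-elements⁺ {p = _ Vec.∷ _}       Vec.here        = here refl
∈-elements⁺ {p = inside Vec.∷ _}  (Vec.there i∈p) = there (∈-map⁺ suc (∈-elements⁺ i∈p))
∈-elements⁺ {p = outside Vec.∷ _} (Vec.there i∈p) = ∈-map⁺ suc (∈-elements⁺ i∈p)

∣p─q∣≤0⇒p⊆q : ∀ {k} {p q : Subset k} → ∣ p ─ q ∣ ≤ 0 → p ⊆ q
∣p─q∣≤0⇒p⊆q {q = q} ∣p─q∣≤0 {x} x∈p with x ∈? q
... | yes x∈q = x∈q
... | no  x∉q =
  contradiction (≤-trans (x∈p⇒∣p-x∣<∣p∣ (x∈p∧x∉q⇒x∈p─q x∈p x∉q)) ∣p─q∣≤0) λ ()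

anyFin⁺ : ∀ {k} (p : Fin k → Bool) {i} → p i ≡ true → anyFin p ≡ true
anyFin⁺ {suc k} p {zero}  pi≡true rewrite pi≡true = refl
anyFin⁺ {suc k} p {suc i} pi≡true with p zero
... | true  = refl
... | false = anyFin⁺ (p ∘ suc) pi≡true

anyFin⁻ : ∀ {k} (p : Fin k → Bool) → anyFin p ≡ true → ∃ λ i → p i ≡ true
anyFin⁻ {suc k} p any≡true with p zero in p0≡true
... | true  = zero , p0≡true
... | false with anyFin⁻ (p ∘ suc) any≡true
...   | i , pi≡true = suc i , pi≡true

2^[n+n]*[2d]^n≤[16d]^n : ∀ d n → 2 ^ (n + n) * (2 * d) ^ n ≤ (16 * d) ^ n
2^[n+n]*[2d]^n≤[16d]^n d zero    = ≤-refl
2^[n+n]*[2d]^n≤[16d]^n d (suc n) = begin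
  2 ^ (suc n + suc n) * (2 * d) ^ suc n       ≡⟨ cong (λ i → 2 ^ suc i * (2 * d) ^ suc n) (+-suc n n) ⟩
  2 * (2 * 2 ^ (n + n)) * (2 * d * (2 * d) ^ n) ≡⟨ regroup (2 ^ (n + n)) d ((2 * d) ^ n) ⟩
  8 * d * (2 ^ (n + n) * (2 * d) ^ n)
    ≤⟨ *-mono-≤ (*-monoˡ-≤ d (m≤m+n 8 8)) (2^[n+n]*[2d]^n≤[16d]^n d n) ⟩
  16 * d * (16 * d) ^ n                       ∎
  where
  open ≤-Reasoning
  regroup : ∀ x d y → 2 * (2 * x) * (2 * d * y) ≡ 8 * d * (x * y)
  regroup = solve-∀

module Subgraphs (H : Graph) where

  V E : Set
  V = Fin (n H)
  E = Fin (m H)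

  end₁ end₂ : E → V
  end₁ e = proj₁ (ends H e)
  end₂ e = proj₂ (ends H e)

  Incident : V → E → Set
  Incident v e = end₁ e ≡ v ⊎ end₂ e ≡ v

  incident? : ∀ v e → Dec (Incident v e)
  incident? v e = (end₁ e ≟ v) ⊎-dec (end₂ e ≟ v)

  incident⇒incidentB : ∀ {v e} → Incident v e → incidentB H v e ≡ true
  incident⇒incidentB {v} {e} v∼e with v ≟ end₁ e | v ≟ end₂ e | v∼e
  ... | yes _     | _         | _           = refl
  ... | no _      | yes _     | _           = refl
  ... | no v≢end₁ | no _      | inj₁ end₁≡v = contradiction (sym end₁≡v) v≢end₁
  ... | no _      | no v≢end₂ | inj₂ end₂≡v = contradiction (sym end₂≡v) v≢end₂

  incidentB⇒incident : ∀ {v e} → incidentB H v e ≡ true → Incident v e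
  incidentB⇒incident {v} {e} _ with v ≟ end₁ e | v ≟ end₂ e
  incidentB⇒incident _  | yes v≡end₁ | _          = inj₁ (sym v≡end₁)
  incidentB⇒incident _  | no _       | yes v≡end₂ = inj₂ (sym v≡end₂)
  incidentB⇒incident () | no _       | no _

  Joins : E → V → V → Set
  Joins e u w = end₁ e ≡ u × end₂ e ≡ w ⊎ end₂ e ≡ u × end₁ e ≡ w

  joins⇒incidentˡ : ∀ {e u w} → Joins e u w → Incident u e
  joins⇒incidentˡ (inj₁ (end₁≡u , _)) = inj₁ end₁≡u
  joins⇒incidentˡ (inj₂ (end₂≡u , _)) = inj₂ end₂≡u

  joins⇒incidentʳ : ∀ {e u w} → Joins e u w → Incident w e
  joins⇒incidentʳ (inj₁ (_ , end₂≡w)) = inj₂ end₂≡w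
  joins⇒incidentʳ (inj₂ (_ , end₁≡w)) = inj₁ end₁≡w

  incidentEdges : V → List E
  incidentEdges v = elements (tabulate (incidentB H v))

  ∈-incidentEdges : ∀ {v e} → Incident v e → e ∈ₗ incidentEdges v
  ∈-incidentEdges {v} {e} v∼e = ∈-elements⁺
    (lookup⇒[]= e (tabulate (incidentB H v)) (trans (lookup∘tabulate (incidentB H v) e) (incident⇒incidentB v∼e)))

  length-incidentEdges : ∀ v → length (incidentEdges v) ≡ degree H v
  length-incidentEdges v = length-elements (tabulate (incidentB H v))

  module _ {J : SubG H} where

    nonIso⁺ : ∀ {u e} → e ∈ J → Incident u e → NonIso H J u
    nonIso⁺ {u} e∈J u∼e =
      anyFin⁺ (λ e → lookup J e ∧ incidentB H u e) (cong₂ _∧_ ([]=⇒lookup e∈J) (incident⇒incidentB u∼e))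

    nonIso⁻ : ∀ {u} → NonIso H J u → ∃ λ e → e ∈ J × Incident u e
    nonIso⁻ {u} nonIso with anyFin⁻ (λ e → lookup J e ∧ incidentB H u e) nonIso
    ... | e , e∈J∧u∼e =
      e , lookup⇒[]= e J (∧-conicalˡ _ _ e∈J∧u∼e) , incidentB⇒incident (∧-conicalʳ _ _ e∈J∧u∼e)

    reach-end₁ : ∀ {u e} → e ∈ J → Incident u e → Reach H J u (end₁ e)
    reach-end₁ e∈J (inj₁ refl) = here
    reach-end₁ e∈J (inj₂ refl) = step _ e∈J (inj₂ (refl , refl)) here

  -- explore s A p k: the search with stack s that has taken the edges A and may
  -- still make p pops and k edge steps; it outputs A once it cannot continue.
  explore : List V → SubG H → ℕ → ℕ → List (SubG H)
  explore _       A zero    _       = [ A ]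
  explore []      A (suc _) _       = [ A ]
  explore (_ ∷ _) A (suc _) zero    = [ A ]
  explore (v ∷ s) A (suc p) (suc k) =
    explore s A p (suc k) ++
    concatMap (λ e → explore (end₁ e ∷ end₂ e ∷ s) (A ∪ ⁅ e ⁆) (suc p) k) (incidentEdges v)

  module _ {d : ℕ} (1≤d : 1 ≤ d) (Δ : MaxDegree≤ H d) where

    1≤2^p*[2d]^k : ∀ p k → 1 ≤ 2 ^ p * (2 * d) ^ k
    1≤2^p*[2d]^k p k = *-mono-≤ (m^n>0 2 p)
      (subst (_≤ (2 * d) ^ k) (^-zeroˡ k) (^-monoˡ-≤ k (≤-trans 1≤d (m≤m+n d (d + 0)))))

    length-explore : ∀ s A p k → length (explore s A p k) ≤ 2 ^ p * (2 * d) ^ k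
    length-explore _       _ zero    k       = 1≤2^p*[2d]^k 0 k
    length-explore []      _ (suc p) k       = 1≤2^p*[2d]^k (suc p) k
    length-explore (_ ∷ _) _ (suc p) zero    = 1≤2^p*[2d]^k (suc p) 0
    length-explore (v ∷ s) A (suc p) (suc k) = begin
      length (explore s A p (suc k) ++ concatMap push (incidentEdges v))
        ≡⟨ length-++ (explore s A p (suc k)) ⟩
      length (explore s A p (suc k)) + length (concatMap push (incidentEdges v))
        ≤⟨ +-mono-≤ (length-explore s A p (suc k)) (length-concatMap≤ push (incidentEdges v) length-push) ⟩
      2 ^ p * (2 * d) ^ suc k + length (incidentEdges v) * (2 ^ suc p * (2 * d) ^ k)
        ≤⟨ +-monoʳ-≤ (2 ^ p * (2 * d) ^ suc k)
                     (*-monoˡ-≤ (2 ^ suc p * (2 * d) ^ k) (subst (_≤ d) (sym (length-incidentEdges v)) (Δ v))) ⟩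
      2 ^ p * (2 * d) ^ suc k + d * (2 ^ suc p * (2 * d) ^ k)
        ≡⟨ pop-or-push (2 ^ p) d ((2 * d) ^ k) ⟩
      2 ^ suc p * (2 * d) ^ suc k ∎
      where
      open ≤-Reasoning
      push : E → List (SubG H)
      push e = explore (end₁ e ∷ end₂ e ∷ s) (A ∪ ⁅ e ⁆) (suc p) k
      length-push : ∀ e → length (push e) ≤ 2 ^ suc p * (2 * d) ^ k
      length-push e = length-explore (end₁ e ∷ end₂ e ∷ s) (A ∪ ⁅ e ⁆) (suc p) k
      pop-or-push : ∀ x d y → x * (2 * d * y) + d * (2 * x * y) ≡ 2 * x * (2 * d * y)
      pop-or-push = solve-∀

  module Completeness (J : SubG H) (roots : List V)
                      (rooted : ∀ {e} → e ∈ J → ∃ λ r → r ∈ₗ roots × Reach H J r (end₁ e)) where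

    Visited : SubG H → V → Set
    Visited A u = u ∈ₗ roots ⊎ ∃ λ e → e ∈ A × Incident u e

    Frontier : List V → SubG H → Set
    Frontier s A = ∀ {u e} → Visited A u → e ∈ J → e ∉ A → Incident u e → u ∈ₗ s

    frontier-∅ : Frontier roots ∅
    frontier-∅ (inj₁ u∈roots)       _ _ _ = u∈roots
    frontier-∅ (inj₂ (_ , e∈∅ , _)) _ _ _ = contradiction e∈∅ ∉⊥

    frontier-pop : ∀ {v s A} → Frontier (v ∷ s) A →
                   ¬ (∃ λ e → e ∈ J × e ∉ A × Incident v e) → Frontier s A
    frontier-pop frontier stuck visited e∈J e∉A u∼e with frontier visited e∈J e∉A u∼e
    ... | here refl = contradiction (_ , e∈J , e∉A , u∼e) stuck
    ... | there u∈s = u∈s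

    visited-∪ : ∀ {A e u} → Visited (A ∪ ⁅ e ⁆) u → Visited A u ⊎ Incident u e
    visited-∪ (inj₁ u∈roots) = inj₁ (inj₁ u∈roots)
    visited-∪ {A} {e} (inj₂ (e′ , e′∈A∪e , u∼e′)) with x∈p∪q⁻ A ⁅ e ⁆ e′∈A∪e
    ... | inj₁ e′∈A = inj₁ (inj₂ (e′ , e′∈A , u∼e′))
    ... | inj₂ e′∈e = inj₂ (subst (Incident _) (x∈⁅y⁆⇒x≡y e e′∈e) u∼e′)

    endpoint-pushed : ∀ {u e s} → Incident u e → u ∈ₗ end₁ e ∷ end₂ e ∷ s
    endpoint-pushed (inj₁ refl) = here refl
    endpoint-pushed (inj₂ refl) = there (here refl)

    frontier-push : ∀ {v s A e} → Frontier (v ∷ s) A → Incident v e →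
                    Frontier (end₁ e ∷ end₂ e ∷ s) (A ∪ ⁅ e ⁆)
    frontier-push frontier v∼e visited e′∈J e′∉A∪e u∼e′ with visited-∪ visited
    ... | inj₂ u∼e  = endpoint-pushed u∼e
    ... | inj₁ visitedA with frontier visitedA e′∈J (e′∉A∪e ∘ x∈p∪q⁺ ∘ inj₁) u∼e′
    ...   | here refl = endpoint-pushed v∼e
    ...   | there u∈s = there (there u∈s)

    explored : ∀ {A u e} → Frontier [] A → Visited A u → e ∈ J → Incident u e → e ∈ A
    explored {A} {e = e} frontier visited e∈J u∼e with e ∈? A
    ... | yes e∈A = e∈A
    ... | no  e∉A = contradiction (frontier visited e∈J e∉A u∼e) λ ()

    explored-along : ∀ {A u w e} → Frontier [] A → Visited A u → Reach H J u w →
                     e ∈ J → Incident w e → e ∈ A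
    explored-along frontier visited here e∈J w∼e = explored frontier visited e∈J w∼e
    explored-along frontier visited (step e′ e′∈J joins reach) e∈J w∼e =
      explored-along frontier
        (inj₂ (e′ , explored frontier visited e′∈J (joins⇒incidentˡ joins) , joins⇒incidentʳ joins))
        reach e∈J w∼e

    emptyStack⇒explored : ∀ {A} → Frontier [] A → J ⊆ A
    emptyStack⇒explored frontier e∈J with rooted e∈J
    ... | r , r∈roots , reach = explored-along frontier (inj₁ r∈roots) reach e∈J (inj₁ refl)

    ∈-explore : ∀ s A p k → A ⊆ J → ∣ J ─ A ∣ ≤ k → length s + k ≤ p → Frontier s A →
                J ∈ₗ explore s A p k
    ∈-explore []      _ zero    _    A⊆J _        _  frontier =
      here (⊆-antisym (emptyStack⇒explored frontier) A⊆J)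
    ∈-explore (_ ∷ _) _ zero    _    _   _        () _
    ∈-explore []      _ (suc _) _    A⊆J _        _  frontier =
      here (⊆-antisym (emptyStack⇒explored frontier) A⊆J)
    ∈-explore (_ ∷ _) _ (suc _) zero A⊆J ∣J─A∣≤0 _  _        =
      here (⊆-antisym (∣p─q∣≤0⇒p⊆q ∣J─A∣≤0) A⊆J)
    ∈-explore (v ∷ s) A (suc p) (suc k) A⊆J ∣J─A∣≤1+k budget frontier
      with any? (λ e → (e ∈? J) ×-dec ¬? (e ∈? A) ×-dec incident? v e)
    ... | no stuck =
      ∈-++⁺ˡ (∈-explore s A p (suc k) A⊆J ∣J─A∣≤1+k (≤-pred budget) (frontier-pop frontier stuck))
    ... | yes (e , e∈J , e∉A , v∼e) =
      ∈-++⁺ʳ (explore s A p (suc k)) (∈-concatMap⁺ _ (lose (∈-incidentEdges v∼e) J∈explore-after-e))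
      where
      A∪e⊆J : A ∪ ⁅ e ⁆ ⊆ J
      A∪e⊆J x∈A∪e with x∈p∪q⁻ A ⁅ e ⁆ x∈A∪e
      ... | inj₁ x∈A = A⊆J x∈A
      ... | inj₂ x∈e = subst (_∈ J) (sym (x∈⁅y⁆⇒x≡y e x∈e)) e∈J
      ∣J─A∪e∣≤k : ∣ J ─ (A ∪ ⁅ e ⁆) ∣ ≤ k
      ∣J─A∪e∣≤k = ≤-pred (begin-strict
        ∣ J ─ (A ∪ ⁅ e ⁆) ∣ ≡⟨ cong ∣_∣ (p─q─r≡p─q∪r J A ⁅ e ⁆) ⟨
        ∣ J ─ A - e ∣       <⟨ x∈p⇒∣p-x∣<∣p∣ (x∈p∧x∉q⇒x∈p─q e∈J e∉A) ⟩
        ∣ J ─ A ∣           ≤⟨ ∣J─A∣≤1+k ⟩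
        suc k               ∎)
        where open ≤-Reasoning
      budget′ : length (end₁ e ∷ end₂ e ∷ s) + k ≤ suc p
      budget′ = subst (_≤ suc p) (cong suc (+-suc (length s) k)) budget
      J∈explore-after-e : J ∈ₗ explore (end₁ e ∷ end₂ e ∷ s) (A ∪ ⁅ e ⁆) (suc p) k
      J∈explore-after-e = ∈-explore (end₁ e ∷ end₂ e ∷ s) (A ∪ ⁅ e ⁆) (suc p) k
        A∪e⊆J ∣J─A∪e∣≤k budget′ (frontier-push frontier v∼e)

  Rooted : (M : ℕ) → (Fin M → V) → SubG H → ℕ → Set
  Rooted M ρ J c = Σ (Fin c → Fin M) λ g →
    Injective _≡_ _≡_ g × (∀ {e} → e ∈ J → ∃ λ k → Reach H J (ρ (g k)) (end₁ e))

  -- Pop budget l + l: the c <= l roots and the l edge steps each put one vertex on the stack.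
  rootedSubgraphs : (M : ℕ) → (Fin M → V) → ℕ → ℕ → List (SubG H)
  rootedSubgraphs M ρ c ℓ = concatMap (λ S → explore (map ρ S) ∅ (ℓ + ℓ) ℓ) (combinations c (allFin M))

  ∈-rootedSubgraphs : ∀ {M ρ c ℓ J} → c ≤ ℓ → ∣ J ∣ ≡ ℓ → Rooted M ρ J c →
                      J ∈ₗ rootedSubgraphs M ρ c ℓ
  ∈-rootedSubgraphs {M} {ρ} {c} {ℓ} {J} c≤ℓ ∣J∣≡ℓ (g , g-injective , reach) =
    ∈-concatMap⁺ _ (lose roots∈combinations
      (∈-explore (map ρ (image g)) ∅ (ℓ + ℓ) ℓ (⊆-min J) ∣J─∅∣≤ℓ budget frontier-∅))
    where
    reachFromRoots : ∀ {e} → e ∈ J → ∃ λ r → r ∈ₗ map ρ (image g) × Reach H J r (end₁ e)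
    reachFromRoots e∈J with reach e∈J
    ... | k , reach-e = ρ (g k) , ∈-map⁺ ρ (∈-image g k) , reach-e
    open Completeness J (map ρ (image g)) reachFromRoots
    roots∈combinations : image g ∈ₗ combinations c (allFin M)
    roots∈combinations = subst (λ k → image g ∈ₗ combinations k (allFin M)) (length-image g g-injective)
                               (∈-combinations (image⊑allFin g))
    ∣J─∅∣≤ℓ : ∣ J ─ ∅ ∣ ≤ ℓ
    ∣J─∅∣≤ℓ = ≤-reflexive (trans (cong ∣_∣ (p─⊥≡p J)) ∣J∣≡ℓ)
    budget : length (map ρ (image g)) + ℓ ≤ ℓ + ℓ
    budget = +-monoˡ-≤ ℓ (subst (_≤ ℓ) (sym (trans (length-map ρ (image g)) (length-image g g-injective))) c≤ℓ)

  module Components {J : SubG H} {c : ℕ} (components : HasComponents H J c) where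

    private
      label : V → Fin c
      label = proj₁ components
      sameLabel⇔reach : ∀ u v → NonIso H J u → NonIso H J v → (label u ≡ label v ⇔ Reach H J u v)
      sameLabel⇔reach = proj₁ (proj₂ components)
      labelled : ∀ k → ∃ λ v → NonIso H J v × label v ≡ k
      labelled = proj₂ (proj₂ components)

    rootVertex : Fin c → V
    rootVertex k = proj₁ (labelled k)

    rootVertex-nonIso : ∀ k → NonIso H J (rootVertex k)
    rootVertex-nonIso k = proj₁ (proj₂ (labelled k))

    label-rootVertex : ∀ k → label (rootVertex k) ≡ k
    label-rootVertex k = proj₂ (proj₂ (labelled k))

    private
      rootEdge-spec : ∀ k → ∃ λ e → e ∈ J × Incident (rootVertex k) e
      rootEdge-spec k = nonIso⁻ {J = J} (rootVertex-nonIso k)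

    rootEdge : Fin c → E
    rootEdge k = proj₁ (rootEdge-spec k)

    rootEdge∈J : ∀ k → rootEdge k ∈ J
    rootEdge∈J k = proj₁ (proj₂ (rootEdge-spec k))

    label-end₁-rootEdge : ∀ k → label (end₁ (rootEdge k)) ≡ k
    label-end₁-rootEdge k = trans (sym (Equivalence.from
      (sameLabel⇔reach _ _ (rootVertex-nonIso k) (nonIso⁺ (rootEdge∈J k) (inj₁ refl)))
      (reach-end₁ (rootEdge∈J k) (proj₂ (proj₂ (rootEdge-spec k))))))
      (label-rootVertex k)

    rootedBy : ∀ {M} (ρ : Fin M → V) (g : Fin c → Fin M) →
               (∀ k → NonIso H J (ρ (g k)) × label (ρ (g k)) ≡ k) → Rooted M ρ J c
    rootedBy ρ g roots = g , g-injective , reach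
      where
      g-injective : Injective _≡_ _≡_ g
      g-injective {k} {k′} gk≡gk′ =
        trans (sym (proj₂ (roots k))) (trans (cong (label ∘ ρ) gk≡gk′) (proj₂ (roots k′)))
      reach : ∀ {e} → e ∈ J → ∃ λ k → Reach H J (ρ (g k)) (end₁ e)
      reach e∈J = _ , Equivalence.to
        (sameLabel⇔reach _ _ (proj₁ (roots _)) (nonIso⁺ e∈J (inj₁ refl))) (proj₂ (roots _))

    rootedByVertices : Rooted (n H) id J c
    rootedByVertices = rootedBy id rootVertex λ k → rootVertex-nonIso k , label-rootVertex k

    rootedByEdges : Rooted (m H) end₁ J c
    rootedByEdges = rootedBy end₁ rootEdge λ k → nonIso⁺ (rootEdge∈J k) (inj₁ refl) , label-end₁-rootEdge k

    components≤edges : c ≤ ∣ J ∣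
    components≤edges = subst₂ _≤_
      (trans (length-map rootEdge (allFin c)) (length-tabulate id)) (length-elements J)
      (Unique-⊆⇒length≤ (map⁺ (proj₁ (proj₂ rootedByEdges)) (allFin⁺ c)) rootEdges⊆J)
      where
      rootEdges⊆J : map rootEdge (allFin c) ⊆ₗ elements J
      rootEdges⊆J e∈ with ∈-map⁻ rootEdge e∈
      ... | k , _ , refl = ∈-elements⁺ (rootEdge∈J k)

  smallerSide : Σ ℕ λ M → M ≡ m H ⊓ n H × Σ (Fin M → V) λ ρ →
                  ∀ {J c} → HasComponents H J c → Rooted M ρ J c
  smallerSide with m H ≤? n H
  ... | yes m≤n = m H , sym (m≤n⇒m⊓n≡m m≤n) , end₁ , Components.rootedByEdges
  ... | no  m≰n = n H , sym (m≥n⇒m⊓n≡n (≰⇒≥ m≰n)) , id , Components.rootedByVertices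

  module _ {d : ℕ} (1≤d : 1 ≤ d) (Δ : MaxDegree≤ H d) where

    length-rootedSubgraphs : ∀ M ρ c ℓ →
      length (rootedSubgraphs M ρ c ℓ) ≤ (M C c) * (2 ^ (ℓ + ℓ) * (2 * d) ^ ℓ)
    length-rootedSubgraphs M ρ c ℓ =
      subst (λ L → length (rootedSubgraphs M ρ c ℓ) ≤ L * (2 ^ (ℓ + ℓ) * (2 * d) ^ ℓ))
        (trans (length-combinations c (allFin M)) (cong (_C c) (length-tabulate id)))
        (length-concatMap≤ _ (combinations c (allFin M)) (λ S → length-explore 1≤d Δ (map ρ S) ∅ (ℓ + ℓ) ℓ))

    length≤ : ∀ {M} (ρ : Fin M → V) {c ℓ} (Js : List (SubG H)) → Unique Js →
              (∀ {J} → J ∈ₗ Js → c ≤ ℓ × ∣ J ∣ ≡ ℓ × Rooted M ρ J c) →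
              length Js ≤ (M C c) * (16 * d) ^ ℓ
    length≤ {M} ρ {c} {ℓ} Js unique rootedJs = begin
      length Js                             ≤⟨ Unique-⊆⇒length≤ unique Js⊆rootedSubgraphs ⟩
      length (rootedSubgraphs M ρ c ℓ)      ≤⟨ length-rootedSubgraphs M ρ c ℓ ⟩
      (M C c) * (2 ^ (ℓ + ℓ) * (2 * d) ^ ℓ) ≤⟨ *-monoʳ-≤ (M C c) (2^[n+n]*[2d]^n≤[16d]^n d ℓ) ⟩
      (M C c) * (16 * d) ^ ℓ                ∎
      where
      open ≤-Reasoning
      Js⊆rootedSubgraphs : Js ⊆ₗ rootedSubgraphs M ρ c ℓ
      Js⊆rootedSubgraphs J∈Js =
        let (c≤ℓ , ∣J∣≡ℓ , rootedJ) = rootedJs J∈Js in ∈-rootedSubgraphs c≤ℓ ∣J∣≡ℓ rootedJ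

claim5 : (d : ℕ) → 1 ≤ d → (H : Graph) → MaxDegree≤ H d →
         (ℓ x c : ℕ) → (Js : List (SubG H)) → Unique Js → All (InJ H ℓ x c) Js →
         length Js ≤ ((m H ⊓ n H) C c) * ((16 * d) ^ ℓ)
claim5 d 1≤d H Δ ℓ x c Js unique members =
  let (M , M≡m⊓n , ρ , rooted) = smallerSide in
  subst (λ M → length Js ≤ (M C c) * (16 * d) ^ ℓ) M≡m⊓n (length≤ 1≤d Δ ρ Js unique λ {J} J∈Js →
    let (∣J∣≡ℓ , _ , components) = All.lookup members J∈Js in
    subst (_ ≤_) ∣J∣≡ℓ (Components.components≤edges {J = J} components) , ∣J∣≡ℓ , rooted components)
  where open Subgraphs H
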